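{- Let $P$ be a finite poset and $\varphi\colon P\to P$ a closure operator. Then $\Delta(P)$ $\mathrm{LC}$-reduces to $\Delta(\varphi(P))$.
   Context: $\Delta(P)$ is the order complex of $P$: the simplicial complex on vertex set $P$ whose faces are the chains of $P$; $\Delta(\varphi(P))$ is the order complex of the induced subposet $\varphi(P)$. A map $\varphi\colon P\to P$ is a closure operator if it is order-preserving, satisfies $x\le\varphi(x)$ or $x\ge\varphi(x)$ for each $x\in P$, and $\varphi^2=\varphi$. For a simplicial complex $\Delta$ with vertex set $V$, $\mathcal{F}(v)$ is the set of facets (maximal faces) containing $v$; for $\kappa\colon V\to[k]=\{1,\dots,k\}$ and a face $S$, $S_\kappa(t)=|\{v\in S:\kappa(v)=t\}|$; a $k$-linear coloring is a surjective $\kappa$ with $\sum_t\min(F_\kappa(t),F'_\kappa(t))=|F\cap F'|$ for all facets $F,F'$. A representative subcomplex w.r.t. $\kappa$ is the subcomplex $\{S\in\Delta:S\subseteq W\}$ induced on a set $W\subseteq V$ with exactly one vertex of each color such that $\mathcal{F}(x)\subseteq\mathcal{F}(y)$ whenever $x\in V$, $y\in W$, $\kappa(x)=\kappa(y)$. $\Delta$ $\mathrm{LC}$-reduces to $\Delta'$ if there is a sequence $\Delta=\Delta_0\supseteq\dots\supseteq\Delta_t=\Delta'$ ($t\ge0$) with each $\Delta_{r+1}$ a representative subcomplex of $\Delta_r$ w.r.t. some linear coloring of $\Delta_r$. -}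

module Defs where

open import Level using (0ℓ)
open import Data.Nat using (ℕ; _⊓_)
open import Data.Fin using (Fin; _≟_)
open import Data.Fin.Subset using (Subset; _∈_; _⊆_; _⊂_; _∩_; ⁅_⁆; ∣_∣)
open import Data.List using (map; allFin)
open import Data.Nat.ListAction using (sum)
open import Data.Vec using (tabulate)
open import Data.Product using (Σ; ∃; ∃-syntax; _×_; _,_)
open import Data.Sum using (_⊎_)
open import Relation.Nullary using (¬_)
open import Relation.Nullary.Decidable using (⌊_⌋)
open import Relation.Binary using (Rel; Decidable; IsPartialOrder)
open import Relation.Binary.PropositionalEquality using (_≡_)
open import Relation.Binary.Construct.Closure.ReflexiveTransitive using (Star)
open import Function using (_⇔_)

record FinPoset (n : ℕ) : Set₁ where
  field
    _≤_       : Rel (Fin n) 0ℓ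
    isPartial : IsPartialOrder _≡_ _≤_
    _≤?_      : Decidable _≤_

-- Closure operator (in the paper's sense: order-preserving, each x is
-- comparable with φ x, idempotent).
record IsClosureOperator {n : ℕ} (P : FinPoset n) (φ : Fin n → Fin n) : Set where
  open FinPoset P
  field
    monotone   : ∀ {x y} → x ≤ y → φ x ≤ φ y
    comparable : ∀ x → x ≤ φ x ⊎ φ x ≤ x
    idempotent : ∀ x → φ (φ x) ≡ φ x

-- Simplicial complexes on ground set Fin n, faces given as a predicate on
-- subsets (vertex set = vertices v with {v} a face).

Complex : ℕ → Set₁
Complex n = Subset n → Set

module _ {n : ℕ} where

  IsVertex : Complex n → Fin n → Set
  IsVertex Δ v = Δ ⁅ v ⁆

  IsFacet : Complex n → Subset n → Set
  IsFacet Δ F = Δ F × (∀ G → Δ G → ¬ (F ⊂ G))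

  FacetsIncl : Complex n → Fin n → Fin n → Set
  FacetsIncl Δ x y = ∀ F → IsFacet Δ F → x ∈ F → y ∈ F

  colorCount : ∀ {k} → (Fin n → Fin k) → Subset n → Fin k → ℕ
  colorCount κ S t = ∣ S ∩ tabulate (λ v → ⌊ κ v ≟ t ⌋) ∣

  -- k-linear coloring of Δ: κ surjective onto [k] from the vertex set, and
  -- Σ_t min(F_κ(t), F'_κ(t)) = |F ∩ F'| for all facets F, F'.
  -- (κ is given on all of Fin n; only its values on vertices matter.)
  IsLinearColoring : Complex n → (k : ℕ) → (Fin n → Fin k) → Set
  IsLinearColoring Δ k κ =
    (∀ t → ∃[ v ] (IsVertex Δ v × κ v ≡ t)) ×
    (∀ F F' → IsFacet Δ F → IsFacet Δ F' →
       sum (map (λ t → colorCount κ F t ⊓ colorCount κ F' t) (allFin k))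
         ≡ ∣ F ∩ F' ∣)

  IsRepresentativeSet : Complex n → ∀ {k} → (Fin n → Fin k) → Subset n → Set
  IsRepresentativeSet Δ κ W =
    (∀ v → v ∈ W → IsVertex Δ v) ×
    (∀ t → ∃[ w ] (w ∈ W × κ w ≡ t × (∀ w' → w' ∈ W → κ w' ≡ t → w' ≡ w))) ×
    (∀ x y → IsVertex Δ x → y ∈ W → κ x ≡ κ y → FacetsIncl Δ x y)

  Induced : Complex n → Subset n → Complex n
  Induced Δ W S = Δ S × S ⊆ W

  _≐_ : Complex n → Complex n → Set
  Δ ≐ Δ' = ∀ S → Δ S ⇔ Δ' S

  LCStep : Complex n → Complex n → Set
  LCStep Δ Δ' =
    Σ ℕ λ k → Σ (Fin n → Fin k) λ κ → IsLinearColoring Δ k κ ×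
      Σ (Subset n) λ W → IsRepresentativeSet Δ κ W × (Δ' ≐ Induced Δ W)

  LCReduces : Complex n → Complex n → Set₁
  LCReduces = Star LCStep

module _ {n : ℕ} (P : FinPoset n) where
  open FinPoset P

  IsChain : Subset n → Set
  IsChain S = ∀ x y → x ∈ S → y ∈ S → x ≤ y ⊎ y ≤ x

  OrderComplex : Complex n
  OrderComplex S = IsChain S

  OrderComplexImage : (Fin n → Fin n) → Complex n
  OrderComplexImage φ S = IsChain S × (∀ x → x ∈ S → ∃[ y ] φ y ≡ x)

-- The points moved by φ are removed one at a time.  A maximal x with x < φ x
-- in the current set U (or, dually, a minimal one with φ x < x) has φ x
-- comparable with everything in U that is comparable with x, so every maximal
-- chain through x contains φ x.  Giving x the color of φ x and every other
-- point of U its own color is then a linear coloring with representatives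
-- U - x.  When only fixed points remain, U = φ(P), and a last step in which
-- every point has its own color identifies the complex with Δ(φ(P)).
module Submission where

open import Defs
open import Data.Nat using (ℕ; zero; suc; _+_; _⊓_; _<_)
open import Data.Nat.Properties using (+-suc; ⊓-comm; m≤n⇒m⊓n≡m)
open import Data.Nat.Induction using (<-wellFounded)
open import Data.Nat.ListAction using (sum)
open import Data.Bool.Properties using (T-≡)
open import Data.Fin using (Fin; zero; suc; _≟_)
open import Data.Fin.Properties using (suc-injective; any?)
open import Data.Fin.Induction using (po-noetherian)
open import Data.Fin.Subset
  using (Subset; inside; outside; ⊤; _∈_; _∉_; _⊆_; _∩_; _∪_; _-_; ⁅_⁆; ∣_∣)
open import Data.Fin.Subset.Properties
  using ( _∈?_; _⊆?_; ⊆-antisym; ⊆-trans; ∩-comm; p⊆q⇒∣p∣≤∣q∣; x∈p∩q⁺; x∈p∩q⁻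
        ; ∈⊤; p⊆p∪q; x∈p∪q⁺; x∈p∪q⁻; x∈⁅x⁆; x∈⁅y⁆⇒x≡y; x∈p∧x≢y⇒x∈p-y; p─q⊆p; x∈p⇒∣p-x∣<∣p∣)
import Data.List as List
open import Data.List using (map; allFin)
open import Data.List.Properties using (map-tabulate; tabulate-cong)
open import Data.Vec using (_∷_; []; tabulate)
open import Data.Vec.Properties using ([]=⇒lookup; lookup⇒[]=; lookup∘tabulate)
open import Data.Vec.Base using (here; there)
open import Data.Product using (∃-syntax; _×_; _,_; proj₁; proj₂)
import Data.Product as Product
open import Data.Sum using (_⊎_; inj₁; inj₂; swap)
open import Data.Empty using (⊥-elim)
open import Function using (_∘_; flip; id)
open import Function.Bundles using (Equivalence; mk⇔)
import Function.Properties.Equivalence as ⇔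
open import Induction.WellFounded using (Acc; acc)
open import Relation.Nullary using (Dec; yes; no; contradiction)
open import Relation.Nullary.Decidable using (⌊_⌋; toWitness; fromWitness; decidable-stable; _×-dec_; ¬?)
open import Relation.Binary using (IsPartialOrder)
import Relation.Binary.Construct.Flip.EqAndOrd as Flip
open import Relation.Binary.PropositionalEquality
  using (_≡_; _≢_; refl; sym; trans; cong; subst; module ≡-Reasoning)
open import Relation.Binary.Construct.Closure.ReflexiveTransitive using (ε; _◅_)

open Equivalence using (to; from)

index : {n : ℕ} {W : Subset n} {x : Fin n} → x ∈ W → Fin ∣ W ∣
index {W = inside  ∷ W} here      = zero
index {W = inside  ∷ W} (there p) = suc (index p)
index {W = outside ∷ W} (there p) = index p

element : {n : ℕ} (W : Subset n) → Fin ∣ W ∣ → Fin n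
element (inside  ∷ W) zero    = zero
element (inside  ∷ W) (suc t) = suc (element W t)
element (outside ∷ W) t       = suc (element W t)

element-∈ : {n : ℕ} (W : Subset n) (t : Fin ∣ W ∣) → element W t ∈ W
element-∈ (inside  ∷ W) zero    = here
element-∈ (inside  ∷ W) (suc t) = there (element-∈ W t)
element-∈ (outside ∷ W) t       = there (element-∈ W t)

index-element : {n : ℕ} (W : Subset n) (t : Fin ∣ W ∣) → index (element-∈ W t) ≡ t
index-element (inside  ∷ W) zero    = refl
index-element (inside  ∷ W) (suc t) = cong suc (index-element W t)
index-element (outside ∷ W) t       = index-element W t

index-injective : {n : ℕ} {W : Subset n} {x y : Fin n} (p : x ∈ W) (q : y ∈ W) →
                  index p ≡ index q → x ≡ y
index-injective {W = inside  ∷ W} here      here      _  = refl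
index-injective {W = inside  ∷ W} here      (there q) ()
index-injective {W = inside  ∷ W} (there p) here      ()
index-injective {W = inside  ∷ W} (there p) (there q) eq =
  cong suc (index-injective p q (suc-injective eq))
index-injective {W = outside ∷ W} (there p) (there q) eq =
  cong suc (index-injective p q eq)

index-irrelevant : {n : ℕ} {W : Subset n} {x : Fin n} (p q : x ∈ W) → index p ≡ index q
index-irrelevant {W = inside  ∷ W} here      here      = refl
index-irrelevant {W = inside  ∷ W} (there p) (there q) = cong suc (index-irrelevant p q)
index-irrelevant {W = outside ∷ W} (there p) (there q) = index-irrelevant p q

index-cong : {n : ℕ} {W : Subset n} {x y : Fin n} → x ≡ y → (p : x ∈ W) (q : y ∈ W) →
             index p ≡ index q
index-cong refl = index-irrelevant

∑ : {k : ℕ} → (Fin k → ℕ) → ℕ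
∑ f = sum (List.tabulate f)

sum-map-allFin : {k : ℕ} (f : Fin k → ℕ) → sum (map f (allFin k)) ≡ ∑ f
sum-map-allFin f = cong sum (map-tabulate id f)

∑-cong : {k : ℕ} {f g : Fin k → ℕ} → (∀ t → f t ≡ g t) → ∑ f ≡ ∑ g
∑-cong eq = cong sum (tabulate-cong eq)

∑-zero : (k : ℕ) → ∑ {k} (λ _ → 0) ≡ 0
∑-zero zero    = refl
∑-zero (suc k) = ∑-zero k

⌊suc≟suc⌋ : {k : ℕ} (a t : Fin k) → ⌊ suc a ≟ suc t ⌋ ≡ ⌊ a ≟ t ⌋
⌊suc≟suc⌋ a t with a ≟ t
... | yes _ = refl
... | no  _ = refl

∑-∣⌊≟⌋∷∣ : {k n : ℕ} (a : Fin k) (X : Fin k → Subset n) →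
           ∑ (λ t → ∣ ⌊ a ≟ t ⌋ ∷ X t ∣) ≡ suc (∑ (λ t → ∣ X t ∣))
∑-∣⌊≟⌋∷∣ zero    X = refl
∑-∣⌊≟⌋∷∣ (suc a) X = begin
  ∣ X zero ∣ + ∑ (λ t → ∣ ⌊ suc a ≟ suc t ⌋ ∷ X (suc t) ∣)
    ≡⟨ cong (∣ X zero ∣ +_) (∑-cong (λ t → cong (λ b → ∣ b ∷ X (suc t) ∣) (⌊suc≟suc⌋ a t))) ⟩
  ∣ X zero ∣ + ∑ (λ t → ∣ ⌊ a ≟ t ⌋ ∷ X (suc t) ∣)
    ≡⟨ cong (∣ X zero ∣ +_) (∑-∣⌊≟⌋∷∣ a (X ∘ suc)) ⟩
  ∣ X zero ∣ + suc (∑ (λ t → ∣ X (suc t) ∣))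
    ≡⟨ +-suc _ _ ⟩
  suc (∣ X zero ∣ + ∑ (λ t → ∣ X (suc t) ∣)) ∎
  where open ≡-Reasoning

module _ {n k : ℕ} (κ : Fin n → Fin k) where

  colorClass : Fin k → Subset n
  colorClass t = tabulate (λ v → ⌊ κ v ≟ t ⌋)

  ∈colorClass⁺ : {v : Fin n} {t : Fin k} → κ v ≡ t → v ∈ colorClass t
  ∈colorClass⁺ {v} {t} κv≡t =
    lookup⇒[]= v _ (trans (lookup∘tabulate _ v) (to T-≡ (fromWitness {a? = κ v ≟ t} κv≡t)))

  ∈colorClass⁻ : {v : Fin n} {t : Fin k} → v ∈ colorClass t → κ v ≡ t
  ∈colorClass⁻ {v} {t} p =
    toWitness {a? = κ v ≟ t}
      (from T-≡ (trans (sym (lookup∘tabulate _ v)) ([]=⇒lookup p)))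

∑-colorCount : {n k : ℕ} (κ : Fin n → Fin k) (S : Subset n) →
               ∑ (colorCount κ S) ≡ ∣ S ∣
∑-colorCount {k = k} κ []            = ∑-zero k
∑-colorCount         κ (outside ∷ S) = ∑-colorCount (κ ∘ suc) S
∑-colorCount         κ (inside  ∷ S) =
  trans (∑-∣⌊≟⌋∷∣ (κ zero) (λ t → S ∩ colorClass (κ ∘ suc) t))
        (cong suc (∑-colorCount (κ ∘ suc) S))

x∈p∧x∉p-y⇒x≡y : {n : ℕ} {p : Subset n} {x y : Fin n} → x ∈ p → x ∉ p - y → x ≡ y
x∈p∧x∉p-y⇒x≡y {x = x} {y} x∈p x∉p-y with x ≟ y
... | yes x≡y = x≡y
... | no  x≢y = contradiction (x∈p∧x≢y⇒x∈p-y x∈p x≢y) x∉p-y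

module _ {n : ℕ} where

  ⊆⇒∣∩∣⊓≡ : {p q c : Subset n} → p ∩ c ⊆ q ∩ c → ∣ p ∩ c ∣ ⊓ ∣ q ∩ c ∣ ≡ ∣ (p ∩ q) ∩ c ∣
  ⊆⇒∣∩∣⊓≡ {p} {q} {c} pc⊆qc =
    trans (m≤n⇒m⊓n≡m (p⊆q⇒∣p∣≤∣q∣ pc⊆qc)) (cong ∣_∣ (⊆-antisym pc⊆pqc pqc⊆pc))
    where
    pc⊆pqc : p ∩ c ⊆ (p ∩ q) ∩ c
    pc⊆pqc i∈pc = let i∈p , i∈c = x∈p∩q⁻ p c i∈pc in
      x∈p∩q⁺ (x∈p∩q⁺ (i∈p , proj₁ (x∈p∩q⁻ q c (pc⊆qc i∈pc))) , i∈c)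
    pqc⊆pc : (p ∩ q) ∩ c ⊆ p ∩ c
    pqc⊆pc i∈pqc = let i∈pq , i∈c = x∈p∩q⁻ (p ∩ q) c i∈pqc in
      x∈p∩q⁺ (proj₁ (x∈p∩q⁻ p q i∈pq) , i∈c)

  nested⇒∣∩∣⊓≡ : {p q c : Subset n} → p ∩ c ⊆ q ∩ c ⊎ q ∩ c ⊆ p ∩ c →
                 ∣ p ∩ c ∣ ⊓ ∣ q ∩ c ∣ ≡ ∣ (p ∩ q) ∩ c ∣
  nested⇒∣∩∣⊓≡         (inj₁ pc⊆qc) = ⊆⇒∣∩∣⊓≡ pc⊆qc
  nested⇒∣∩∣⊓≡ {p} {q} (inj₂ qc⊆pc) =
    trans (⊓-comm _ _) (trans (⊆⇒∣∩∣⊓≡ qc⊆pc) (cong (λ r → ∣ r ∩ _ ∣) (∩-comm q p)))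

  pointed-⊆-total : {A B : Subset n} (w : Fin n) →
    (∀ {i} → i ∈ A → w ∈ A) → (∀ {i} → i ∈ B → w ∈ B) →
    (∀ {i j} → i ∈ A → j ∈ B → i ≢ w → j ≢ w → i ≡ j) →
    A ⊆ B ⊎ B ⊆ A
  pointed-⊆-total {A} {B} w w∈A w∈B same with A ⊆? B
  ... | yes A⊆B = inj₁ A⊆B
  ... | no  A⊈B = inj₂ B⊆A
    where
    B⊆A : B ⊆ A
    B⊆A {i} i∈B with i ∈? A
    ... | yes i∈A = i∈A
    ... | no  i∉A = ⊥-elim (A⊈B (λ {j} → A⊆B {j}))
      where
      A⊆B : A ⊆ B
      A⊆B {j} j∈A with j ≟ w | i ≟ w
      ... | yes refl | _        = w∈B i∈B
      ... | no  _    | yes refl = contradiction (w∈A j∈A) i∉A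
      ... | no  j≢w  | no  i≢w  = subst (_∈ B) (sym (same j∈A i∈B j≢w i≢w)) i∈B

module _ {n : ℕ} where

  ≐-trans : {Δ₁ Δ₂ Δ₃ : Complex n} → Δ₁ ≐ Δ₂ → Δ₂ ≐ Δ₃ → Δ₁ ≐ Δ₃
  ≐-trans eq₁₂ eq₂₃ S = ⇔.trans (eq₁₂ S) (eq₂₃ S)

  ≐-Induced : {Δ Δ₀ : Complex n} {U W : Subset n} →
              Δ ≐ Induced Δ₀ U → W ⊆ U → Induced Δ₀ W ≐ Induced Δ W
  ≐-Induced eq W⊆U S =
    mk⇔ (λ (d₀ , S⊆W) → from (eq S) (d₀ , ⊆-trans S⊆W W⊆U) , S⊆W)
        (λ (d , S⊆W) → proj₁ (to (eq S) d) , S⊆W)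

  FacetsIncl-refl : (Δ : Complex n) (x : Fin n) → FacetsIncl Δ x x
  FacetsIncl-refl Δ x F _ x∈F = x∈F

-- Coloring every vertex z by its representative r z ∈ W is linear as long as
-- at most one vertex lies outside W: a facet then meets each color class in
-- ∅, {w} or {w, z}.
module Retraction {n : ℕ} (Δ : Complex n) (U W : Subset n) (r : Fin n → Fin n)
  (faces⊆U          : ∀ {S} → Δ S → S ⊆ U)
  (U⊆vertices       : ∀ {v} → v ∈ U → IsVertex Δ v)
  (W⊆U              : W ⊆ U)
  (r∈W              : ∀ z → r z ∈ W)
  (r-fixes-W        : ∀ {w} → w ∈ W → r w ≡ w)
  (r-dominates      : ∀ {z} → z ∈ U → FacetsIncl Δ z (r z))
  (U∖W-subsingleton : ∀ {z z′} → z ∈ U → z′ ∈ U → z ∉ W → z′ ∉ W → z ≡ z′)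
  where

  κ : Fin n → Fin ∣ W ∣
  κ z = index (r∈W z)

  rep : Fin ∣ W ∣ → Fin n
  rep = element W

  κ-rep : ∀ t → κ (rep t) ≡ t
  κ-rep t = trans (index-cong (r-fixes-W rep∈W) (r∈W (rep t)) rep∈W) (index-element W t)
    where rep∈W = element-∈ W t

  r-of-color : ∀ {z t} → κ z ≡ t → r z ≡ rep t
  r-of-color {z} {t} κz≡t =
    index-injective (r∈W z) (element-∈ W t) (trans κz≡t (sym (index-element W t)))

  W-rep : ∀ {w t} → w ∈ W → κ w ≡ t → w ≡ rep t
  W-rep w∈W κw≡t = trans (sym (r-fixes-W w∈W)) (r-of-color κw≡t)

  private
    C : Fin ∣ W ∣ → Subset n
    C = colorClass κ

  classes-nested : ∀ {F F′} → IsFacet Δ F → IsFacet Δ F′ → ∀ t →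
                   F ∩ C t ⊆ F′ ∩ C t ⊎ F′ ∩ C t ⊆ F ∩ C t
  classes-nested {F} {F′} fF fF′ t = pointed-⊆-total (rep t) (rep-in fF) (rep-in fF′) outside-W-equal
    where
    rep-in : ∀ {G i} → IsFacet Δ G → i ∈ G ∩ C t → rep t ∈ G ∩ C t
    rep-in {G} fG i∈GC = let i∈G , i∈C = x∈p∩q⁻ G (C t) i∈GC in
      x∈p∩q⁺ ( subst (_∈ G) (r-of-color (∈colorClass⁻ κ i∈C))
                 (r-dominates (faces⊆U (proj₁ fG) i∈G) G fG i∈G)
             , ∈colorClass⁺ κ (κ-rep t))
    ∉W : ∀ {i} → i ∈ C t → i ≢ rep t → i ∉ W
    ∉W i∈C i≢rep i∈W = i≢rep (W-rep i∈W (∈colorClass⁻ κ i∈C))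
    outside-W-equal : ∀ {i j} → i ∈ F ∩ C t → j ∈ F′ ∩ C t → i ≢ rep t → j ≢ rep t → i ≡ j
    outside-W-equal i∈FC j∈F′C i≢rep j≢rep =
      let i∈F , i∈C = x∈p∩q⁻ F (C t) i∈FC
          j∈F′ , j∈C = x∈p∩q⁻ F′ (C t) j∈F′C
      in U∖W-subsingleton (faces⊆U (proj₁ fF) i∈F) (faces⊆U (proj₁ fF′) j∈F′)
                          (∉W i∈C i≢rep) (∉W j∈C j≢rep)

  isLinearColoring : IsLinearColoring Δ ∣ W ∣ κ
  isLinearColoring = (λ t → rep t , U⊆vertices (W⊆U (element-∈ W t)) , κ-rep t) , intersection-size
    where
    open ≡-Reasoning
    intersection-size : ∀ F F′ → IsFacet Δ F → IsFacet Δ F′ →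
              sum (map (λ t → colorCount κ F t ⊓ colorCount κ F′ t) (allFin ∣ W ∣)) ≡ ∣ F ∩ F′ ∣
    intersection-size F F′ fF fF′ = begin
      sum (map (λ t → colorCount κ F t ⊓ colorCount κ F′ t) (allFin ∣ W ∣))
        ≡⟨ sum-map-allFin (λ t → colorCount κ F t ⊓ colorCount κ F′ t) ⟩
      ∑ (λ t → colorCount κ F t ⊓ colorCount κ F′ t)
        ≡⟨ ∑-cong (nested⇒∣∩∣⊓≡ ∘ classes-nested fF fF′) ⟩
      ∑ (colorCount κ (F ∩ F′))
        ≡⟨ ∑-colorCount κ (F ∩ F′) ⟩
      ∣ F ∩ F′ ∣ ∎

  isRepresentativeSet : IsRepresentativeSet Δ κ W
  isRepresentativeSet =
      (λ _ w∈W → U⊆vertices (W⊆U w∈W))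
    , (λ t → rep t , element-∈ W t , κ-rep t , λ _ w∈W κw≡t → W-rep w∈W κw≡t)
    , λ x y x-vertex y∈W κx≡κy →
        subst (FacetsIncl Δ x) (trans (r-of-color κx≡κy) (sym (W-rep y∈W refl)))
              (r-dominates (faces⊆U x-vertex (x∈⁅x⁆ x)))

  lcStep : ∀ {Δ′} → Δ′ ≐ Induced Δ W → LCStep Δ Δ′
  lcStep eq = ∣ W ∣ , κ , isLinearColoring , W , isRepresentativeSet , eq

module _ {n : ℕ} where

  _ᵒᵖ : FinPoset n → FinPoset n
  Q ᵒᵖ = record
    { _≤_       = flip _≤_
    ; isPartial = Flip.isPartialOrder isPartial
    ; _≤?_      = flip _≤?_
    }
    where open FinPoset Q

  IsClosureOperator-ᵒᵖ : {Q : FinPoset n} {φ : Fin n → Fin n} →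
                         IsClosureOperator Q φ → IsClosureOperator (Q ᵒᵖ) φ
  IsClosureOperator-ᵒᵖ cl = record
    { monotone   = λ y≤x → monotone y≤x
    ; comparable = swap ∘ comparable
    ; idempotent = idempotent
    }
    where open IsClosureOperator cl

  IsChain-ᵒᵖ : {Q : FinPoset n} {S : Subset n} → IsChain Q S → IsChain (Q ᵒᵖ) S
  IsChain-ᵒᵖ chain x y x∈S y∈S = swap (chain x y x∈S y∈S)

  ChainsIn : FinPoset n → Subset n → Complex n
  ChainsIn Q = Induced (OrderComplex Q)

  ChainsIn-ᵒᵖ : (Q : FinPoset n) (U : Subset n) → ChainsIn Q U ≐ ChainsIn (Q ᵒᵖ) U
  ChainsIn-ᵒᵖ Q U S = mk⇔ (Product.map₁ (IsChain-ᵒᵖ {Q})) (Product.map₁ (IsChain-ᵒᵖ {Q ᵒᵖ}))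

module _ {n : ℕ} (Q : FinPoset n) where
  open FinPoset Q
  private module ≤ = IsPartialOrder isPartial

  maximal-exists : {Pr : Fin n → Set} → (∀ z → Dec (Pr z)) → ∀ {x} → Pr x →
                   ∃[ y ] (Pr y × (∀ {z} → Pr z → y ≤ z → y ≡ z))
  maximal-exists {Pr} Pr? = climb (po-noetherian isPartial _)
    where
    climb : ∀ {x} → Acc (flip (λ a b → a ≤ b × a ≢ b)) x → Pr x →
            ∃[ y ] (Pr y × (∀ {z} → Pr z → y ≤ z → y ≡ z))
    climb {x} (acc above) px with any? (λ z → Pr? z ×-dec (x ≤? z) ×-dec ¬? (x ≟ z))
    ... | yes (z , pz , x≤z , x≢z) = climb (above (x≤z , x≢z)) pz
    ... | no  none = x , px , λ {z} pz x≤z →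
      decidable-stable (x ≟ z) (λ x≢z → none (z , pz , x≤z , x≢z))

  IsChain-∪⁅⁆ : ∀ {S y} → IsChain Q S → (∀ z → z ∈ S → z ≤ y ⊎ y ≤ z) →
                IsChain Q (S ∪ ⁅ y ⁆)
  IsChain-∪⁅⁆ {S} {y} chain comparable-y a b a∈ b∈
    with x∈p∪q⁻ S ⁅ y ⁆ a∈ | x∈p∪q⁻ S ⁅ y ⁆ b∈
  ... | inj₁ a∈S | inj₁ b∈S = chain a b a∈S b∈S
  ... | inj₁ a∈S | inj₂ b∈y rewrite x∈⁅y⁆⇒x≡y y b∈y = comparable-y a a∈S
  ... | inj₂ a∈y | inj₁ b∈S rewrite x∈⁅y⁆⇒x≡y y a∈y = swap (comparable-y b b∈S)
  ... | inj₂ a∈y | inj₂ b∈y rewrite x∈⁅y⁆⇒x≡y y a∈y | x∈⁅y⁆⇒x≡y y b∈y = inj₁ ≤.refl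

  module _ {Δ : Complex n} {U : Subset n} (Δ≐ : Δ ≐ ChainsIn Q U) where

    faces⊆ : ∀ {S} → Δ S → S ⊆ U
    faces⊆ {S} ΔS = proj₂ (to (Δ≐ S) ΔS)

    singleton-faces : ∀ {v} → v ∈ U → IsVertex Δ v
    singleton-faces {v} v∈U = from (Δ≐ ⁅ v ⁆) (singleton-chain , singleton-⊆)
      where
      singleton-chain : IsChain Q ⁅ v ⁆
      singleton-chain a b a∈ b∈ rewrite x∈⁅y⁆⇒x≡y v a∈ | x∈⁅y⁆⇒x≡y v b∈ = inj₁ ≤.refl
      singleton-⊆ : ⁅ v ⁆ ⊆ U
      singleton-⊆ a∈ rewrite x∈⁅y⁆⇒x≡y v a∈ = v∈U

    facet-saturated : ∀ {F y} → IsFacet Δ F → y ∈ U → (∀ z → z ∈ F → z ≤ y ⊎ y ≤ z) → y ∈ F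
    facet-saturated {F} {y} (ΔF , maximal) y∈U comparable-y with y ∈? F
    ... | yes y∈F = y∈F
    ... | no  y∉F = ⊥-elim (maximal (F ∪ ⁅ y ⁆) ΔF∪y (p⊆p∪q ⁅ y ⁆ , y , x∈p∪q⁺ (inj₂ (x∈⁅x⁆ y)) , y∉F))
      where
      F∪y⊆U : F ∪ ⁅ y ⁆ ⊆ U
      F∪y⊆U a∈ with x∈p∪q⁻ F ⁅ y ⁆ a∈
      ... | inj₁ a∈F = faces⊆ ΔF a∈F
      ... | inj₂ a∈y rewrite x∈⁅y⁆⇒x≡y y a∈y = y∈U
      ΔF∪y : Δ (F ∪ ⁅ y ⁆)
      ΔF∪y = from (Δ≐ _) (IsChain-∪⁅⁆ (proj₁ (to (Δ≐ F) ΔF)) comparable-y , F∪y⊆U)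

module _ {n : ℕ} (Q : FinPoset n) {φ : Fin n → Fin n} (cl : IsClosureOperator Q φ) where
  open FinPoset Q
  open IsClosureOperator cl
  private module ≤ = IsPartialOrder isPartial

  MovedUpIn : Subset n → Fin n → Set
  MovedUpIn U z = z ∈ U × z ≤ φ z × z ≢ φ z

  movedUpIn? : ∀ U z → Dec (MovedUpIn U z)
  movedUpIn? U z = (z ∈? U) ×-dec (z ≤? φ z) ×-dec ¬? (z ≟ φ z)

  maximal-moved-up⇒comparable-closure : ∀ {U x} → x ≤ φ x →
    (∀ {z} → MovedUpIn U z → x ≤ z → x ≡ z) →
    ∀ {z} → z ∈ U → x ≤ z ⊎ z ≤ x → z ≤ φ x ⊎ φ x ≤ z
  maximal-moved-up⇒comparable-closure x≤φx maximal z∈U (inj₂ z≤x) = inj₁ (≤.trans z≤x x≤φx)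
  maximal-moved-up⇒comparable-closure {x = x} x≤φx maximal {z} z∈U (inj₁ x≤z)
    with comparable z
  ... | inj₂ φz≤z = inj₂ (≤.trans (monotone x≤z) φz≤z)
  ... | inj₁ z≤φz with z ≟ φ z
  ...   | yes z≡φz = inj₂ (subst (φ x ≤_) (sym z≡φz) (monotone x≤z))
  ...   | no  z≢φz = inj₁ (subst (_≤ φ x) (maximal (z∈U , z≤φz , z≢φz) x≤z) x≤φx)

  ∃-dominated-up : ∀ {U Δ x₀} → (∀ z → φ z ∈ U) → Δ ≐ ChainsIn Q U → MovedUpIn U x₀ →
                   ∃[ x ] (x ∈ U × x ≢ φ x × FacetsIncl Δ x (φ x))
  ∃-dominated-up {U} {Δ} φ∈U Δ≐ moved =
    let x , (x∈U , x≤φx , x≢φx) , maximal = maximal-exists Q (movedUpIn? U) moved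
        dominated : ∀ F → IsFacet Δ F → x ∈ F → φ x ∈ F
        dominated F fF x∈F = facet-saturated Q Δ≐ fF (φ∈U x) λ z z∈F →
          maximal-moved-up⇒comparable-closure x≤φx maximal (faces⊆ Q Δ≐ (proj₁ fF) z∈F)
            (proj₁ (to (Δ≐ F) (proj₁ fF)) x z x∈F z∈F)
    in x , x∈U , x≢φx , dominated

module _ {n : ℕ} (P : FinPoset n) {φ : Fin n → Fin n} (cl : IsClosureOperator P φ) where
  open FinPoset P
  open IsClosureOperator cl

  ∃-dominated : ∀ {U Δ x₀} → (∀ z → φ z ∈ U) → Δ ≐ ChainsIn P U → x₀ ∈ U → x₀ ≢ φ x₀ →
                ∃[ x ] (x ∈ U × x ≢ φ x × FacetsIncl Δ x (φ x))
  ∃-dominated {U} {x₀ = x₀} φ∈U Δ≐ x₀∈U x₀≢φx₀ with comparable x₀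
  ... | inj₁ x₀≤φx₀ = ∃-dominated-up P cl φ∈U Δ≐ (x₀∈U , x₀≤φx₀ , x₀≢φx₀)
  ... | inj₂ φx₀≤x₀ = ∃-dominated-up (P ᵒᵖ) (IsClosureOperator-ᵒᵖ cl) φ∈U
                        (≐-trans Δ≐ (ChainsIn-ᵒᵖ P U)) (x₀∈U , φx₀≤x₀ , x₀≢φx₀)

  retract : Subset n → Fin n → Fin n
  retract W z with z ∈? W
  ... | yes _ = z
  ... | no  _ = φ z

  retract-∈ : ∀ {W} → (∀ z → φ z ∈ W) → ∀ z → retract W z ∈ W
  retract-∈ {W} φ∈W z with z ∈? W
  ... | yes z∈W = z∈W
  ... | no  _   = φ∈W z

  retract-fixes : ∀ {W w} → w ∈ W → retract W w ≡ w
  retract-fixes {W} {w} w∈W with w ∈? W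
  ... | yes _   = refl
  ... | no  w∉W = contradiction w∈W w∉W

  φ∈-without-moved : ∀ {U x} → (∀ z → φ z ∈ U) → x ≢ φ x → ∀ z → φ z ∈ U - x
  φ∈-without-moved φ∈U x≢φx z = x∈p∧x≢y⇒x∈p-y (φ∈U z) λ φz≡x →
    x≢φx (trans (sym φz≡x) (trans (sym (idempotent z)) (cong φ φz≡x)))

  image≐chains : ∀ {U} → (∀ z → φ z ∈ U) → (∀ {z} → z ∈ U → z ≡ φ z) →
                 OrderComplexImage P φ ≐ ChainsIn P U
  image≐chains {U} φ∈U fixed S = mk⇔
    (λ (chain , in-image) → chain , λ x∈S →
       let y , φy≡x = in-image _ x∈S in subst (_∈ U) φy≡x (φ∈U y))
    (λ (chain , S⊆U) → chain , λ x x∈S → x , sym (fixed (S⊆U x∈S)))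

  final-step : ∀ {U Δ} → (∀ z → φ z ∈ U) → (∀ {z} → z ∈ U → z ≡ φ z) →
               Δ ≐ ChainsIn P U → LCStep Δ (OrderComplexImage P φ)
  final-step {U} {Δ} φ∈U fixed Δ≐ =
    Retraction.lcStep Δ U U (retract U) (faces⊆ P Δ≐) (singleton-faces P Δ≐) (λ z∈U → z∈U)
      (retract-∈ φ∈U) retract-fixes
      (λ z∈U → subst (FacetsIncl Δ _) (sym (retract-fixes z∈U)) (FacetsIncl-refl Δ _))
      (λ z∈U _ z∉U _ → contradiction z∈U z∉U)
      (≐-trans (image≐chains φ∈U fixed) (≐-Induced Δ≐ (λ z∈U → z∈U)))

  deletion-step : ∀ {U Δ x} → (∀ z → φ z ∈ U) → Δ ≐ ChainsIn P U →
                  x ∈ U → x ≢ φ x → FacetsIncl Δ x (φ x) → LCStep Δ (ChainsIn P (U - x))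
  deletion-step {U} {Δ} {x} φ∈U Δ≐ x∈U x≢φx dominated =
    Retraction.lcStep Δ U (U - x) (retract (U - x)) (faces⊆ P Δ≐) (singleton-faces P Δ≐)
      U-x⊆U (retract-∈ (φ∈-without-moved φ∈U x≢φx)) retract-fixes retract-dominates
      (λ z∈U z′∈U z∉ z′∉ → trans (x∈p∧x∉p-y⇒x≡y z∈U z∉) (sym (x∈p∧x∉p-y⇒x≡y z′∈U z′∉)))
      (≐-Induced Δ≐ U-x⊆U)
    where
    U-x⊆U : U - x ⊆ U
    U-x⊆U = p─q⊆p U ⁅ x ⁆
    retract-dominates : ∀ {z} → z ∈ U → FacetsIncl Δ z (retract (U - x) z)
    retract-dominates {z} z∈U with z ∈? U - x
    ... | yes _   = FacetsIncl-refl Δ z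
    ... | no  z∉W rewrite x∈p∧x∉p-y⇒x≡y z∈U z∉W = dominated

  reduce : ∀ {U Δ} → Acc _<_ ∣ U ∣ → (∀ z → φ z ∈ U) → Δ ≐ ChainsIn P U →
           LCReduces Δ (OrderComplexImage P φ)
  reduce {U} (acc smaller) φ∈U Δ≐ with any? (λ z → (z ∈? U) ×-dec ¬? (z ≟ φ z))
  ... | no none = final-step φ∈U fixed Δ≐ ◅ ε
    where
    fixed : ∀ {z} → z ∈ U → z ≡ φ z
    fixed {z} z∈U = decidable-stable (z ≟ φ z) λ z≢φz → none (z , z∈U , z≢φz)
  ... | yes (x₀ , x₀∈U , x₀≢φx₀) =
    let x , x∈U , x≢φx , dominated = ∃-dominated φ∈U Δ≐ x₀∈U x₀≢φx₀
    in deletion-step φ∈U Δ≐ x∈U x≢φx dominated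
       ◅ reduce (smaller (x∈p⇒∣p-x∣<∣p∣ x∈U)) (φ∈-without-moved φ∈U x≢φx) (λ _ → ⇔.refl)

theorem7p7 : (n : ℕ) (P : FinPoset n) (φ : Fin n → Fin n) →
    IsClosureOperator P φ →
    LCReduces (OrderComplex P) (OrderComplexImage P φ)
theorem7p7 n P φ cl =
  reduce P cl (<-wellFounded _) (λ _ → ∈⊤) (λ S → mk⇔ (λ chain → chain , λ {_} _ → ∈⊤) proj₁)
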